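{- Let $G=(V,E)$ be a finite graph with $n=|V|$ nodes having a perfect matching $M^*$. No $(\rho,x)\in Q$ is simultaneously produced by some element of $R_n$ using rule $\mathsf{R}(1)$, by some element of $R_n$ using rule $\mathsf{R}(3)$, and by some element of $R_n$ using rule $\mathsf{R}(6)$.
   Context: Ranking: given a bijection $\sigma:V\to[n]$ (permutation; $\sigma(u)$ is the rank of $u$), list all unordered pairs of distinct nodes lexicographically by $\sigma$ (write each pair $\{a,b\}$ with $\sigma(a)<\sigma(b)$; $\{a_1,b_1\}$ precedes $\{a_2,b_2\}$ iff $\sigma(a_1)<\sigma(a_2)$, or $a_1=a_2$ and $\sigma(b_1)<\sigma(b_2)$), and probe them in this order: when $\{a,b\}$ is probed, if both are unmatched and $\{a,b\}\in E$, match them to each other. The resulting matching is $M(\sigma)$; "matched in $\sigma$", "partner in $\sigma$" refer to $M(\sigma)$. For $u\in V$, $u^*$ denotes the partner of $u$ in the fixed perfect matching $M^*$. $\Omega$ is the set of all permutations. $\sigma_u^i$ is obtained from $\sigma$ by removing $u$ (keeping the relative order of the other nodes) and reinserting $u$ at rank $i$. $Q=\{(\sigma,v):\sigma\in\Omega,\ v\text{ matched in }\sigma\}$; $R_n=\{(\sigma,u):\sigma\in\Omega,\ \sigma(u)=n,\ u\text{ unmatched in }\sigma\}$. Rules: for $(\sigma,u)\in R_n$ and each $i\in[n]$, consider $\sigma_u^i$. If $u$ is unmatched in $\sigma_u^i$: $\mathsf{R}(1)$ produces $(\sigma_u^i,u^*)$; $\mathsf{R}(2)$ produces $(\sigma_u^i,v)$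 where $v$ is the partner of $u^*$ in $\sigma_u^i$. If $u$ is matched in $\sigma_u^i$: $\mathsf{R}(3)$ produces $(\sigma_u^i,u)$; moreover (a) if $u^*$ is matched to $u$ in $\sigma_u^i$, $\mathsf{R}(4)$ produces $(\sigma_u^i,u^*)$; (b) if $u^*$ is matched to some $v\ne u$ in $\sigma_u^i$, $\mathsf{R}(5)$ produces $(\sigma_u^i,v)$; (c) if $u^*$ is unmatched in $\sigma_u^i$, $\mathsf{R}(6)$ produces $(\sigma_u^i,v_o)$ where $v_o$ is the partner of $u^*$ in $\sigma$. "$(\rho,x)$ is produced using $\mathsf{R}(i)$ by $(\sigma,u)$" means that for some $j\in[n]$, rule $\mathsf{R}(i)$ applies to $\sigma_u^j$ and produces $(\rho,x)$. -}

module Defs where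

open import Data.Nat using (ℕ; zero; suc; _∸_; _<ᵇ_)
open import Data.Nat.Properties using () renaming (_≟_ to _≟ℕ_)
open import Data.Bool using (Bool; true; false; if_then_else_)
open import Data.Fin using (Fin; toℕ; _≟_)
open import Data.List using (List; []; _∷_; map; _++_; foldl; concatMap; filter; allFin; upTo)
open import Data.Maybe using (Maybe; just; nothing)
open import Data.Product using (_×_; _,_; ∃; ∃-syntax; Σ-syntax)
open import Data.Fin.Permutation using (Permutation′; _⟨$⟩ʳ_)
open import Relation.Nullary.Decidable using (⌊_⌋)
open import Relation.Binary.PropositionalEquality using (_≡_; _≢_)

record Graph (n : ℕ) : Set where
  field
    adj    : Fin n → Fin n → Bool
    sym    : ∀ a b → adj a b ≡ adj b a
    irrefl : ∀ a → adj a a ≡ false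

record PerfectMatching {n : ℕ} (G : Graph n) : Set where
  field
    mate      : Fin n → Fin n
    mate-edge : ∀ u → Graph.adj G u (mate u) ≡ true
    mate-inv  : ∀ u → mate (mate u) ≡ u
    mate-ne   : ∀ u → mate u ≢ u

Mate : ℕ → Set
Mate n = Fin n → Maybe (Fin n)

Rank : ℕ → Set
Rank n = Fin n → ℕ

-- rank function of a permutation σ : V → [n]  (0-indexed: rank i+1 of the paper is i)
rank : ∀ {n} → Permutation′ n → Rank n
rank σ u = toℕ (σ ⟨$⟩ʳ u)

-- nodes listed by increasing rank (for a bijective rank function this is the sorted order)
order : ∀ {n} → Rank n → List (Fin n)
order {n} r = concatMap (λ i → filter (λ w → r w ≟ℕ i) (allFin n)) (upTo n)

pairs : ∀ {A : Set} → List A → List (A × A)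
pairs []       = []
pairs (a ∷ as) = map (a ,_) as ++ pairs as

setMate : ∀ {n} → Mate n → Fin n → Fin n → Mate n
setMate m a b x =
  if ⌊ x ≟ a ⌋ then just b else (if ⌊ x ≟ b ⌋ then just a else m x)

probe : ∀ {n} → Graph n → Mate n → Fin n × Fin n → Mate n
probe G m (a , b) with m a | m b | Graph.adj G a b
... | nothing | nothing | true = setMate m a b
... | _       | _       | _    = m

Mr : ∀ {n} → Graph n → Rank n → Mate n
Mr G r = foldl (probe G) (λ _ → nothing) (pairs (order r))

M : ∀ {n} → Graph n → Permutation′ n → Mate n
M G σ = Mr G (rank σ)

MatchedR : ∀ {n} → Graph n → Rank n → Fin n → Set
MatchedR G r v = ∃[ w ] Mr G r v ≡ just w

UnmatchedR : ∀ {n} → Graph n → Rank n → Fin n → Set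
UnmatchedR G r v = Mr G r v ≡ nothing

Matched : ∀ {n} → Graph n → Permutation′ n → Fin n → Set
Matched G σ = MatchedR G (rank σ)

Unmatched : ∀ {n} → Graph n → Permutation′ n → Fin n → Set
Unmatched G σ = UnmatchedR G (rank σ)

-- σ_u^j : remove u, reinsert it at (0-indexed) rank j; returned as a rank function
reinsert : ∀ {n} → Permutation′ n → Fin n → Fin n → Rank n
reinsert σ u j w =
  if ⌊ w ≟ u ⌋ then toℕ j
  else (let s  = rank σ w
            s′ = if s <ᵇ rank σ u then s else s ∸ 1
        in if s′ <ᵇ toℕ j then s′ else suc s′)

InRn : ∀ {n} → Graph n → Permutation′ n → Fin n → Set
InRn {n} G σ u = (suc (rank σ u) ≡ n) × Unmatched G σ u

InQ : ∀ {n} → Graph n → Permutation′ n → Fin n → Set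
InQ G ρ x = Matched G ρ x

-- the rules applied to σ_u^j (τ is its rank function), producing node x
module _ {n} (G : Graph n) (P : PerfectMatching G) (σ : Permutation′ n) (u : Fin n) where
  private
    u* = PerfectMatching.mate P u

  data RuleApplies (τ : Rank n) : ℕ → Fin n → Set where
    r1 : UnmatchedR G τ u → RuleApplies τ 1 u*
    r2 : ∀ {v} → UnmatchedR G τ u → Mr G τ u* ≡ just v → RuleApplies τ 2 v
    r3 : MatchedR G τ u → RuleApplies τ 3 u
    r4 : Mr G τ u* ≡ just u → RuleApplies τ 4 u*
    r5 : ∀ {v} → MatchedR G τ u → Mr G τ u* ≡ just v → v ≢ u → RuleApplies τ 5 v
    r6 : ∀ {vo} → MatchedR G τ u → UnmatchedR G τ u* → M G σ u* ≡ just vo → RuleApplies τ 6 vo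

  ProducedBy : ℕ → Permutation′ n → Fin n → Set
  ProducedBy k ρ x =
    ∃[ j ] ((∀ w → rank ρ w ≡ reinsert σ u j w) × RuleApplies (reinsert σ u j) k x)

ProducedFromRn : ∀ {n} (G : Graph n) → PerfectMatching G → ℕ → Permutation′ n → Fin n → Set
ProducedFromRn {n} G P k ρ x =
  ∃[ σ ] Σ[ u ∈ Fin n ] (InRn G σ u × ProducedBy G P σ u k ρ x)

module Submission where

-- If (ρ, x) were produced by all three rules, then x would be matched in ρ with two unmatched
-- neighbours in ρ: its M*-partner u₁ (rule 1) and u₆* (rule 6, where x is the partner of u₆*
-- in σ₆); and ρ would arise from some σ by moving x, unmatched at the last rank of σ, to an
-- earlier rank (rule 3).
--
-- Compare the run of Ranking on G with the run on G with x isolated. While x is free both runs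
-- agree off x. Once x is matched, neither run uses x any more, and two runs of the same graph
-- whose free sets differ in one vertex keep differing in at most one vertex. So at the end the
-- free sets agree off x and at most one further vertex d. The run with x isolated does not see
-- where x sits in the ranking, so it is the same for ρ and σ. If u₁ ≠ u₆*, one of them is not d
-- and hence free in σ, next to the free vertex x, contradicting maximality of M(σ). So u₁ = u₆*,
-- whence x = u₆ is matched to u₆* in σ₆, contradicting (σ₆, u₆) ∈ Rₙ.

open import Defs
open import Data.Bool using (Bool; true; false; if_then_else_; _∧_; _∨_)
open import Data.Bool.Properties using (∨-zeroʳ)
open import Data.Empty using (⊥; ⊥-elim)
open import Data.Fin using (Fin; toℕ; _≟_)
open import Data.Fin.Properties using (toℕ<n; toℕ-injective)
open import Data.Fin.Permutation using (Permutation′; _⟨$⟩ʳ_; _⟨$⟩ˡ_; inverseˡ)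
open import Data.List using (List; []; _∷_; [_]; map; _++_; foldl; concatMap; filter; allFin; upTo)
open import Data.List.Membership.Propositional using (_∈_)
open import Data.List.Properties
  using ( foldl-++; filter-accept; filter-reject; filter-++; filter-≐; filter-none
        ; concatMap-cong; concatMap-++; upTo-∷ʳ; ++-identityʳ)
import Data.List.Relation.Unary.All as All
open import Data.List.Membership.Propositional.Properties
  using (∈-++⁺ˡ; ∈-++⁺ʳ; ∈-map⁺; ∈-concat⁺′; ∈-filter⁺; ∈-allFin; ∈-upTo⁺)
open import Data.List.Relation.Unary.Any using (here; there)
open import Data.Maybe using (just; nothing; is-nothing)
open import Data.Nat using (ℕ; zero; suc; _+_; _∸_; _<_; _≤_; s≤s; _<ᵇ_)
open import Data.Nat.Properties
  using ( <ᵇ-reflects-<; ≤⇒≯; <⇒≱; ≮⇒≥; ≤∧≢⇒<; ≤-pred; ≤-refl; ≤-trans; <⇒≤; <-irrefl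
        ; n≤1+n; m≤n+m; m∸n+n≡m; suc-injective; _<?_)
  renaming (_≟_ to _≟ℕ_)
open import Data.Product using (_×_; _,_; ∃-syntax; proj₁; proj₂)
open import Data.Sum using (_⊎_; inj₁; inj₂)
open import Relation.Nullary using (¬_; Dec; yes; no; does; ¬?)
open import Relation.Nullary.Decidable using (dec-true; dec-false; decidable-stable)
open import Relation.Nullary.Reflects using (ofʸ; ofⁿ)
open import Function using (_∘_; case_of_)
open import Level using (Level)
open import Relation.Unary using (Pred; Decidable)
open import Relation.Unary.Properties using (_∩?_)
open import Relation.Binary.PropositionalEquality
  using (_≡_; _≢_; refl; sym; trans; cong; cong₂; cong-app; subst; _≗_; module ≡-Reasoning)
open ≡-Reasoning

private
  variable
    n : ℕ

-- Free sets along a run of Ranking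

Adjacency : ℕ → Set
Adjacency n = Fin n → Fin n → Bool

FreeSet : ℕ → Set
FreeSet n = Fin n → Bool

free : Mate n → FreeSet n
free m v = is-nothing (m v)

hits : Fin n → Fin n → Fin n → Bool
hits a b v = does (v ≟ a) ∨ does (v ≟ b)

fire : Adjacency n → FreeSet n → Fin n → Fin n → Bool
fire A S a b = S a ∧ S b ∧ A a b

probeFree : Adjacency n → FreeSet n → Fin n × Fin n → FreeSet n
probeFree A S (a , b) = if fire A S a b then (λ v → if hits a b v then false else S v) else S

run : Adjacency n → FreeSet n → List (Fin n × Fin n) → FreeSet n
run A = foldl (probeFree A)

hits-left : (a b : Fin n) → hits a b a ≡ true
hits-left a b rewrite dec-true (a ≟ a) refl = refl

hits-right : (a b : Fin n) → hits a b b ≡ true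
hits-right a b rewrite dec-true (b ≟ b) refl = ∨-zeroʳ (does (b ≟ a))

hits-miss : {a b v : Fin n} → v ≢ a → v ≢ b → hits a b v ≡ false
hits-miss {a = a} {b} {v} v≢a v≢b rewrite dec-false (v ≟ a) v≢a | dec-false (v ≟ b) v≢b = refl

module _ (A : Adjacency n) (S : FreeSet n) (a b : Fin n) where

  probeFree-idle : fire A S a b ≡ false → probeFree A S (a , b) ≡ S
  probeFree-idle f rewrite f = refl

  probeFree-hit : fire A S a b ≡ true → ∀ {v} → hits a b v ≡ true → probeFree A S (a , b) v ≡ false
  probeFree-hit f h rewrite f | h = refl

  probeFree-miss : ∀ {v} → hits a b v ≡ false → probeFree A S (a , b) v ≡ S v
  probeFree-miss {v} h with fire A S a b
  ... | true rewrite h = refl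
  ... | false = refl

module _ (A : Adjacency n) {S : FreeSet n} {a b : Fin n} where

  fire-true : fire A S a b ≡ true → S a ≡ true × S b ≡ true × A a b ≡ true
  fire-true f with S a | S b | A a b
  ... | true | true | true = refl , refl , refl

  fire-false : fire A S a b ≡ false → A a b ≡ true → S a ≡ false ⊎ S b ≡ false
  fire-false f ab with S a | S b
  ... | false | _     = inj₁ refl
  ... | true  | false = inj₂ refl
  ... | true  | true  with () ← trans (sym f) ab

probe-free : (G : Graph n) (m : Mate n) → ∀ p → free (probe G m p) ≗ probeFree (Graph.adj G) (free m) p
probe-free G m (a , b) v with m a | m b | Graph.adj G a b
... | just _  | _       | _     = refl
... | nothing | just _  | _     = refl
... | nothing | nothing | false = refl
... | nothing | nothing | true with v ≟ a
...   | yes _ = refl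
...   | no _ with v ≟ b
...     | yes _ = refl
...     | no _ = refl

probeFree-cong : (A : Adjacency n) {S S′ : FreeSet n} → S ≗ S′ → ∀ p → probeFree A S p ≗ probeFree A S′ p
probeFree-cong A {S} {S′} S≗S′ (a , b) v
  with fire A S a b | fire A S′ a b | cong₂ (λ s t → s ∧ t ∧ A a b) (S≗S′ a) (S≗S′ b)
... | true  | true  | _ = cong (if hits a b v then false else_) (S≗S′ v)
... | false | false | _ = S≗S′ v

run-free : (G : Graph n) (m : Mate n) {S : FreeSet n} → free m ≗ S →
           ∀ L → free (foldl (probe G) m L) ≗ run (Graph.adj G) S L
run-free G m m≗S [] = m≗S
run-free G m m≗S (p ∷ L) =
  run-free G (probe G m p) (λ v → trans (probe-free G m p v) (probeFree-cong (Graph.adj G) m≗S p v)) L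

probeFree-mono : (A : Adjacency n) (S : FreeSet n) → ∀ p {v} → S v ≡ false → probeFree A S p v ≡ false
probeFree-mono A S (a , b) {v} Sv with fire A S a b
... | false = Sv
... | true with hits a b v
...   | true  = refl
...   | false = Sv

run-mono : (A : Adjacency n) → ∀ L {S : FreeSet n} {v} → S v ≡ false → run A S L v ≡ false
run-mono A []      Sv = Sv
run-mono A (p ∷ L) {S} Sv = run-mono A L (probeFree-mono A S p Sv)

probeFree-covers : (A : Adjacency n) (S : FreeSet n) (a b : Fin n) → A a b ≡ true →
                   probeFree A S (a , b) a ≡ false ⊎ probeFree A S (a , b) b ≡ false
probeFree-covers A S a b Aab = by-freeness (S a) refl (S b) refl
  where
  by-freeness : ∀ s → S a ≡ s → ∀ t → S b ≡ t →
                probeFree A S (a , b) a ≡ false ⊎ probeFree A S (a , b) b ≡ false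
  by-freeness false Sa _     _  = inj₁ (probeFree-mono A S (a , b) Sa)
  by-freeness true  _  false Sb = inj₂ (probeFree-mono A S (a , b) Sb)
  by-freeness true  Sa true  Sb = inj₁ (probeFree-hit A S a b fired (hits-left a b))
    where
    fired : fire A S a b ≡ true
    fired rewrite Sa | Sb = Aab

run-covers : (A : Adjacency n) → ∀ L {S : FreeSet n} {a b} → (a , b) ∈ L → A a b ≡ true →
             run A S L a ≡ false ⊎ run A S L b ≡ false
run-covers A (_ ∷ L) {S} {a} {b} (here refl) Aab with probeFree-covers A S a b Aab
... | inj₁ a-taken = inj₁ (run-mono A L a-taken)
... | inj₂ b-taken = inj₂ (run-mono A L b-taken)
run-covers A (p ∷ L) (there ab∈L) Aab = run-covers A L ab∈L Aab

pairs-complete : {A : Set} (L : List A) {a b : A} → a ∈ L → b ∈ L → a ≢ b →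
                 (a , b) ∈ pairs L ⊎ (b , a) ∈ pairs L
pairs-complete (c ∷ L) (here refl) (here refl) a≢b = ⊥-elim (a≢b refl)
pairs-complete (c ∷ L) (here refl) (there b∈L) _   = inj₁ (∈-++⁺ˡ (∈-map⁺ (c ,_) b∈L))
pairs-complete (c ∷ L) (there a∈L) (here refl) _   = inj₂ (∈-++⁺ˡ (∈-map⁺ (c ,_) a∈L))
pairs-complete (c ∷ L) (there a∈L) (there b∈L) a≢b with pairs-complete L a∈L b∈L a≢b
... | inj₁ ab = inj₁ (∈-++⁺ʳ (map (c ,_) L) ab)
... | inj₂ ba = inj₂ (∈-++⁺ʳ (map (c ,_) L) ba)

∈-order : (σ : Permutation′ n) (w : Fin n) → w ∈ order (rank σ)
∈-order {n} σ w =
  ∈-concat⁺′ (∈-filter⁺ (λ v → rank σ v ≟ℕ rank σ w) (∈-allFin w) refl)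
             (∈-map⁺ (λ i → filter (λ v → rank σ v ≟ℕ i) (allFin n)) (∈-upTo⁺ (toℕ<n (σ ⟨$⟩ʳ w))))

Free : Graph n → Rank n → FreeSet n
Free G r = run (Graph.adj G) (λ _ → true) (pairs (order r))

free-Mr : (G : Graph n) (r : Rank n) → free (Mr G r) ≗ Free G r
free-Mr G r = run-free G (λ _ → nothing) (λ _ → refl) (pairs (order r))

Free-maximal : (G : Graph n) (σ : Permutation′ n) {a b : Fin n} → a ≢ b → Graph.adj G a b ≡ true →
               Free G (rank σ) a ≡ false ⊎ Free G (rank σ) b ≡ false
Free-maximal G σ {a} {b} a≢b ab with pairs-complete (order (rank σ)) (∈-order σ a) (∈-order σ b) a≢b
... | inj₁ ab∈ = run-covers (Graph.adj G) _ ab∈ ab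
... | inj₂ ba∈ with run-covers (Graph.adj G) _ ba∈ (trans (Graph.sym G b a) ab)
...   | inj₁ b-taken = inj₂ b-taken
...   | inj₂ a-taken = inj₁ a-taken

-- The partner relation

Partners : Graph n → Mate n → Set
Partners G m = ∀ {v w} → m v ≡ just w → Graph.adj G v w ≡ true × m w ≡ just v

module _ (m : Mate n) (a b : Fin n) where

  setMate-left : setMate m a b a ≡ just b
  setMate-left with a ≟ a
  ... | yes _   = refl
  ... | no a≢a = ⊥-elim (a≢a refl)

  setMate-right : a ≢ b → setMate m a b b ≡ just a
  setMate-right a≢b with b ≟ a
  ... | yes b≡a = ⊥-elim (a≢b (sym b≡a))
  ... | no _ with b ≟ b
  ...   | yes _   = refl
  ...   | no b≢b = ⊥-elim (b≢b refl)

  setMate-other : ∀ {v} → v ≢ a → v ≢ b → setMate m a b v ≡ m v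
  setMate-other {v} v≢a v≢b with v ≟ a
  ... | yes v≡a = ⊥-elim (v≢a v≡a)
  ... | no _ with v ≟ b
  ...   | yes v≡b = ⊥-elim (v≢b v≡b)
  ...   | no _    = refl

probe-partners : (G : Graph n) {m : Mate n} → Partners G m → ∀ p → Partners G (probe G m p)
probe-partners G {m} ok (a , b) with m a in ma | m b in mb | Graph.adj G a b in ab
... | just _  | _       | _     = ok
... | nothing | just _  | _     = ok
... | nothing | nothing | false = ok
... | nothing | nothing | true  = matched
  where
  a≢b : a ≢ b
  a≢b refl with () ← trans (sym ab) (Graph.irrefl G a)

  matched : Partners G (setMate m a b)
  matched {v} {w} e with v ≟ a | v ≟ b
  ... | yes refl | _        with refl ← e = ab , setMate-right m a b a≢b
  ... | no _     | yes refl with refl ← e = trans (Graph.sym G b a) ab , setMate-left m a b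
  ... | no v≢a   | no v≢b   with ok e
  ...   | vw , mw = vw , trans (setMate-other m a b w≢a w≢b) mw
    where
    w≢a : w ≢ a
    w≢a refl with () ← trans (sym ma) mw
    w≢b : w ≢ b
    w≢b refl with () ← trans (sym mb) mw

Mr-partners : (G : Graph n) (r : Rank n) → Partners G (Mr G r)
Mr-partners G r = go (pairs (order r)) (λ ())
  where
  go : ∀ L {m} → Partners G m → Partners G (foldl (probe G) m L)
  go []      ok = ok
  go (p ∷ L) ok = go L (probe-partners G ok p)

-- Isolating a vertex

isolate : Fin n → Adjacency n → Adjacency n
isolate x A a b = if does (a ≟ x) ∨ does (b ≟ x) then false else A a b

isolate-away : (x : Fin n) (A : Adjacency n) {a b : Fin n} → a ≢ x → b ≢ x → isolate x A a b ≡ A a b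
isolate-away x A {a} {b} a≢x b≢x rewrite dec-false (a ≟ x) a≢x | dec-false (b ≟ x) b≢x = refl

isolate-left : (x : Fin n) (A : Adjacency n) (b : Fin n) → isolate x A x b ≡ false
isolate-left x A b rewrite dec-true (x ≟ x) refl = refl

isolate-right : (x : Fin n) (A : Adjacency n) (a : Fin n) → isolate x A a x ≡ false
isolate-right x A a rewrite dec-true (x ≟ x) refl | ∨-zeroʳ (does (a ≟ x)) = refl

isolate-edge : (x : Fin n) (A : Adjacency n) {a b : Fin n} → isolate x A a b ≡ true → a ≢ x × b ≢ x
isolate-edge x A {a} {b} e = a≢x , b≢x
  where
  a≢x : a ≢ x
  a≢x refl with () ← trans (sym e) (isolate-left x A b)
  b≢x : b ≢ x
  b≢x refl with () ← trans (sym e) (isolate-right x A a)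

Ends : Fin n → Fin n → Fin n → Fin n → Set
Ends a b e o = (e ≡ a × o ≡ b) ⊎ (e ≡ b × o ≡ a)

ends-hit : {a b e o : Fin n} → Ends a b e o → hits a b e ≡ true
ends-hit {a = a} {b} (inj₁ (refl , refl)) = hits-left a b
ends-hit {a = a} {b} (inj₂ (refl , refl)) = hits-right a b

ends-miss : {a b e o v : Fin n} → Ends a b e o → v ≢ e → v ≢ o → hits a b v ≡ false
ends-miss (inj₁ (refl , refl)) v≢e v≢o = hits-miss v≢e v≢o
ends-miss (inj₂ (refl , refl)) v≢e v≢o = hits-miss v≢o v≢e

module _ (x : Fin n) where

  AgreeOff : Fin n → FreeSet n → FreeSet n → Set
  AgreeOff d S S′ = ∀ v → v ≢ x → v ≢ d → S v ≡ S′ v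

  -- S is the free set of a run on G and S′ that of the same run on G with x isolated.
  NearlyAgree : FreeSet n → FreeSet n → Set
  NearlyAgree S S′ = (S x ≡ true × AgreeOff x S S′) ⊎ (S x ≡ false × ∃[ d ] AgreeOff d S S′)

  AgreeOff-sym : {d : Fin n} {S S′ : FreeSet n} → AgreeOff d S S′ → AgreeOff d S′ S
  AgreeOff-sym agree v v≢x v≢d = sym (agree v v≢x v≢d)

  AgreeOff⇒NearlyAgree : {S S′ : FreeSet n} → AgreeOff x S S′ → NearlyAgree S S′
  AgreeOff⇒NearlyAgree {S} agree with S x
  ... | true  = inj₁ (refl , agree)
  ... | false = inj₂ (refl , x , agree)

  AgreeOff-moved : {d e : Fin n} {S S′ : FreeSet n} → AgreeOff d S S′ →
                   e ≢ x → S e ≡ true → S′ e ≡ false → AgreeOff e S S′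
  AgreeOff-moved {d} {e} agree e≢x Se S′e with e ≟ d
  ... | yes refl = agree
  ... | no e≢d with () ← trans (sym Se) (trans (agree e e≢x e≢d) S′e)

  module _ (A A′ : Adjacency n) {S S′ : FreeSet n} {a b : Fin n} where

    probeFree-agreeOff : {d : Fin n} → fire A S a b ≡ fire A′ S′ a b → AgreeOff d S S′ →
                         AgreeOff d (probeFree A S (a , b)) (probeFree A′ S′ (a , b))
    probeFree-agreeOff same agree v v≢x v≢d with fire A S a b | fire A′ S′ a b | same
    ... | true  | true  | _ = cong (if hits a b v then false else_) (agree v v≢x v≢d)
    ... | false | false | _ = agree v v≢x v≢d

    -- A probe that fires only in the first run moves the exceptional vertex from e to o.
    probeFree-settle : {e o : Fin n} → fire A S a b ≡ true → fire A′ S′ a b ≡ false → Ends a b e o →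
                       e ≡ x ⊎ S′ e ≡ false → AgreeOff e S S′ →
                       AgreeOff o (probeFree A S (a , b)) (probeFree A′ S′ (a , b))
    probeFree-settle {e} f f′ ends e-ok agree v v≢x v≢o
      rewrite cong-app (probeFree-idle A′ S′ a b f′) v with v ≟ e
    ... | yes refl = trans (probeFree-hit A S a b f (ends-hit ends)) (sym (taken e-ok))
      where
      taken : v ≡ x ⊎ S′ v ≡ false → S′ v ≡ false
      taken (inj₁ v≡x)  = ⊥-elim (v≢x v≡x)
      taken (inj₂ S′v) = S′v
    ... | no v≢e = trans (probeFree-miss A S a b (ends-miss ends v≢e v≢o)) (agree v v≢x v≢e)

module _ (A : Adjacency n) (x : Fin n) (x-isolated : ∀ {a b} → A a b ≡ true → a ≢ x × b ≢ x) where

  probeFree-perturbed-fired : {S S′ : FreeSet n} {a b d : Fin n} →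
    fire A S a b ≡ true → fire A S′ a b ≡ false → AgreeOff x d S S′ →
    ∃[ d′ ] AgreeOff x d′ (probeFree A S (a , b)) (probeFree A S′ (a , b))
  probeFree-perturbed-fired f f′ agree with fire-true A f
  ... | Sa , Sb , ab with fire-false A f′ ab
  ...   | inj₁ S′a = _ , probeFree-settle x A A f f′ (inj₁ (refl , refl)) (inj₂ S′a)
                          (AgreeOff-moved x agree (proj₁ (x-isolated ab)) Sa S′a)
  ...   | inj₂ S′b = _ , probeFree-settle x A A f f′ (inj₂ (refl , refl)) (inj₂ S′b)
                          (AgreeOff-moved x agree (proj₂ (x-isolated ab)) Sb S′b)

  probeFree-perturbed : {S S′ : FreeSet n} {d : Fin n} → AgreeOff x d S S′ →
    ∀ p → ∃[ d′ ] AgreeOff x d′ (probeFree A S p) (probeFree A S′ p)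
  probeFree-perturbed {S} {S′} agree (a , b) = by-fires (fire A S a b) refl (fire A S′ a b) refl
    where
    by-fires : ∀ f → fire A S a b ≡ f → ∀ f′ → fire A S′ a b ≡ f′ →
               ∃[ d′ ] AgreeOff x d′ (probeFree A S (a , b)) (probeFree A S′ (a , b))
    by-fires true  f true  f′ = _ , probeFree-agreeOff x A A (trans f (sym f′)) agree
    by-fires false f false f′ = _ , probeFree-agreeOff x A A (trans f (sym f′)) agree
    by-fires true  f false f′ = probeFree-perturbed-fired f f′ agree
    by-fires false f true  f′ with probeFree-perturbed-fired f′ f (AgreeOff-sym x agree)
    ... | d′ , agree′ = d′ , AgreeOff-sym x agree′

module _ (A : Adjacency n) (x : Fin n) where

  private
    A′ : Adjacency n
    A′ = isolate x A

  fire-isolate : {S S′ : FreeSet n} {a b : Fin n} → a ≢ x → b ≢ x → AgreeOff x x S S′ →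
                 fire A S a b ≡ fire A′ S′ a b
  fire-isolate {a = a} {b} a≢x b≢x agree
    rewrite agree a a≢x a≢x | agree b b≢x b≢x | isolate-away x A a≢x b≢x = refl

  probeFree-isolate-taken : {S : FreeSet n} → S x ≡ false → ∀ p → probeFree A S p ≡ probeFree A′ S p
  probeFree-isolate-taken {S} Sx (a , b) =
    cong (λ f → if f then (λ v → if hits a b v then false else S v) else S) same
    where
    same : fire A S a b ≡ fire A′ S a b
    same with a ≟ x | b ≟ x
    ... | yes refl | _        rewrite Sx = refl
    ... | no _     | yes refl rewrite Sx = refl
    ... | no _     | no _     = refl

  nearlyAgree-fired : {S S′ : FreeSet n} {a b : Fin n} → Dec (a ≡ x) → Dec (b ≡ x) →
    fire A S a b ≡ true → fire A′ S′ a b ≡ false → AgreeOff x x S S′ →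
    NearlyAgree x (probeFree A S (a , b)) (probeFree A′ S′ (a , b))
  nearlyAgree-fired {S} {S′} {b = b} (yes refl) _ f f′ agree =
    inj₂ (probeFree-hit A S x b f (hits-left x b) ,
          b , probeFree-settle x A A′ {S} {S′} f f′ (inj₁ (refl , refl)) (inj₁ refl) agree)
  nearlyAgree-fired {S} {S′} {a = a} (no _) (yes refl) f f′ agree =
    inj₂ (probeFree-hit A S a x f (hits-right a x) ,
          a , probeFree-settle x A A′ {S} {S′} f f′ (inj₂ (refl , refl)) (inj₁ refl) agree)
  nearlyAgree-fired (no a≢x) (no b≢x) f f′ agree
    with () ← trans (sym f) (trans (fire-isolate a≢x b≢x agree) f′)

  nearlyAgree-free-step : {S S′ : FreeSet n} → AgreeOff x x S S′ →
                          ∀ p → NearlyAgree x (probeFree A S p) (probeFree A′ S′ p)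
  nearlyAgree-free-step {S} {S′} agree (a , b) = by-fires (fire A S a b) refl (fire A′ S′ a b) refl
    where
    by-fires : ∀ f → fire A S a b ≡ f → ∀ f′ → fire A′ S′ a b ≡ f′ →
               NearlyAgree x (probeFree A S (a , b)) (probeFree A′ S′ (a , b))
    by-fires true  f true  f′ = AgreeOff⇒NearlyAgree x (probeFree-agreeOff x A A′ (trans f (sym f′)) agree)
    by-fires false f false f′ = AgreeOff⇒NearlyAgree x (probeFree-agreeOff x A A′ (trans f (sym f′)) agree)
    by-fires true  f false f′ = nearlyAgree-fired (a ≟ x) (b ≟ x) f f′ agree
    by-fires false f true  f′ with isolate-edge x A (proj₂ (proj₂ (fire-true A′ {S′} f′)))
    ... | a≢x , b≢x with () ← trans (sym f) (trans (fire-isolate a≢x b≢x agree) f′)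

  nearlyAgree-step : {S S′ : FreeSet n} → NearlyAgree x S S′ →
                     ∀ p → NearlyAgree x (probeFree A S p) (probeFree A′ S′ p)
  nearlyAgree-step {S} {S′} (inj₁ (_ , agree)) p = nearlyAgree-free-step {S} {S′} agree p
  nearlyAgree-step {S} {S′} (inj₂ (Sx , _ , agree)) p =
    subst (λ T → NearlyAgree x T (probeFree A′ S′ p)) (sym (probeFree-isolate-taken {S} Sx p))
          (inj₂ (probeFree-mono A′ S p Sx , probeFree-perturbed A′ x (isolate-edge x A) {S} {S′} agree p))

  nearlyAgree-run : {S S′ : FreeSet n} → NearlyAgree x S S′ → ∀ L → NearlyAgree x (run A S L) (run A′ S′ L)
  nearlyAgree-run close []      = close
  nearlyAgree-run close (p ∷ L) = nearlyAgree-run (nearlyAgree-step close p) L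

-- Runs with x isolated ignore the rank of x

others : Fin n → List (Fin n) → List (Fin n)
others x = filter (λ v → ¬? (v ≟ x))

module _ {x a : Fin n} {L : List (Fin n)} where

  others-reject : a ≡ x → others x (a ∷ L) ≡ others x L
  others-reject a≡x = filter-reject (λ v → ¬? (v ≟ x)) (λ a≢x → a≢x a≡x)

  others-accept : a ≢ x → others x (a ∷ L) ≡ a ∷ others x L
  others-accept = filter-accept (λ v → ¬? (v ≟ x))

module _ (A : Adjacency n) (x : Fin n) where

  private
    A′ : Adjacency n
    A′ = isolate x A

  probeFree-isolated : (S : FreeSet n) {a b : Fin n} → a ≡ x ⊎ b ≡ x → probeFree A′ S (a , b) ≡ S
  probeFree-isolated S {a} {b} at-x = probeFree-idle A′ S a b (non-edge (S a) (S b) (isolated at-x))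
    where
    isolated : a ≡ x ⊎ b ≡ x → A′ a b ≡ false
    isolated (inj₁ refl) = isolate-left x A b
    isolated (inj₂ refl) = isolate-right x A a
    non-edge : ∀ s t → A′ a b ≡ false → s ∧ t ∧ A′ a b ≡ false
    non-edge false _     _  = refl
    non-edge true  false _  = refl
    non-edge true  true  ab = ab

  run-isolated-from : {a : Fin n} → a ≡ x → ∀ S L → run A′ S (map (a ,_) L) ≡ S
  run-isolated-from a≡x S []      = refl
  run-isolated-from {a} a≡x S (b ∷ L) =
    trans (cong (λ T → run A′ T (map (a ,_) L)) (probeFree-isolated S (inj₁ a≡x))) (run-isolated-from a≡x S L)

  run-isolated-to : ∀ S a L → run A′ S (map (a ,_) L) ≡ run A′ S (map (a ,_) (others x L))
  run-isolated-to S a []      = refl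
  run-isolated-to S a (b ∷ L) = by-cases (b ≟ x)
    where
    by-cases : Dec (b ≡ x) → run A′ S (map (a ,_) (b ∷ L)) ≡ run A′ S (map (a ,_) (others x (b ∷ L)))
    by-cases (yes b≡x) = begin
      run A′ (probeFree A′ S (a , b)) (map (a ,_) L)
        ≡⟨ cong (λ T → run A′ T (map (a ,_) L)) (probeFree-isolated S (inj₂ b≡x)) ⟩
      run A′ S (map (a ,_) L)                        ≡⟨ run-isolated-to S a L ⟩
      run A′ S (map (a ,_) (others x L))             ≡⟨ cong (λ l → run A′ S (map (a ,_) l)) (others-reject b≡x) ⟨
      run A′ S (map (a ,_) (others x (b ∷ L)))       ∎
    by-cases (no b≢x) = begin
      run A′ (probeFree A′ S (a , b)) (map (a ,_) L)            ≡⟨ run-isolated-to _ a L ⟩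
      run A′ (probeFree A′ S (a , b)) (map (a ,_) (others x L))
        ≡⟨ cong (λ l → run A′ S (map (a ,_) l)) (others-accept b≢x) ⟨
      run A′ S (map (a ,_) (others x (b ∷ L)))                  ∎

  run-isolated-others : ∀ S L → run A′ S (pairs L) ≡ run A′ S (pairs (others x L))
  run-isolated-others S []      = refl
  run-isolated-others S (a ∷ L) = begin
    run A′ S (map (a ,_) L ++ pairs L)         ≡⟨ foldl-++ (probeFree A′) S (map (a ,_) L) (pairs L) ⟩
    run A′ (run A′ S (map (a ,_) L)) (pairs L) ≡⟨ by-cases (a ≟ x) ⟩
    run A′ S (pairs (others x (a ∷ L)))        ∎
    where
    by-cases : Dec (a ≡ x) → run A′ (run A′ S (map (a ,_) L)) (pairs L) ≡ run A′ S (pairs (others x (a ∷ L)))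
    by-cases (yes a≡x) = begin
      run A′ (run A′ S (map (a ,_) L)) (pairs L) ≡⟨ cong (λ T → run A′ T (pairs L)) (run-isolated-from a≡x S L) ⟩
      run A′ S (pairs L)                         ≡⟨ run-isolated-others S L ⟩
      run A′ S (pairs (others x L))              ≡⟨ cong (λ l → run A′ S (pairs l)) (others-reject a≡x) ⟨
      run A′ S (pairs (others x (a ∷ L)))        ∎
    by-cases (no a≢x) = begin
      run A′ (run A′ S (map (a ,_) L)) (pairs L)                        ≡⟨ run-isolated-others _ L ⟩
      run A′ (run A′ S (map (a ,_) L)) (pairs (others x L))
        ≡⟨ cong (λ T → run A′ T (pairs (others x L))) (run-isolated-to S a L) ⟩
      run A′ (run A′ S (map (a ,_) (others x L))) (pairs (others x L))
        ≡⟨ foldl-++ (probeFree A′) S (map (a ,_) (others x L)) (pairs (others x L)) ⟨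
      run A′ S (pairs (a ∷ others x L))
        ≡⟨ cong (λ l → run A′ S (pairs l)) (others-accept a≢x) ⟨
      run A′ S (pairs (others x (a ∷ L)))                               ∎

filter-concatMap : {A B : Set} {p : Level} {P : Pred B p} (P? : Decidable P) (f : A → List B) →
                   ∀ xs → filter P? (concatMap f xs) ≡ concatMap (filter P? ∘ f) xs
filter-concatMap P? f []       = refl
filter-concatMap P? f (y ∷ ys) =
  trans (filter-++ P? (f y) (concatMap f ys)) (cong (filter P? (f y) ++_) (filter-concatMap P? f ys))

filter-filter : {A : Set} {p q : Level} {P : Pred A p} {Q : Pred A q} (P? : Decidable P) (Q? : Decidable Q) →
                ∀ xs → filter P? (filter Q? xs) ≡ filter (P? ∩? Q?) xs
filter-filter P? Q? []       = refl
filter-filter P? Q? (y ∷ ys) with does (Q? y)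
... | false with does (P? y)
...   | true  = filter-filter P? Q? ys
...   | false = filter-filter P? Q? ys
filter-filter P? Q? (y ∷ ys) | true with does (P? y)
...   | true  = cong (y ∷_) (filter-filter P? Q? ys)
...   | false = filter-filter P? Q? ys

module _ (x : Fin n) where

  othersLevel : Rank n → ℕ → List (Fin n)
  othersLevel r i = filter ((λ w → ¬? (w ≟ x)) ∩? (λ w → r w ≟ℕ i)) (allFin n)

  others-order : (r : Rank n) → others x (order r) ≡ concatMap (othersLevel r) (upTo n)
  others-order r =
    trans (filter-concatMap _ (λ i → filter (λ w → r w ≟ℕ i) (allFin n)) (upTo n))
          (concatMap-cong (λ i → filter-filter _ _ (allFin n)) (upTo n))

  othersLevel-cong : {r r′ : Rank n} {i i′ : ℕ} →
                     (∀ {w} → w ≢ x → r w ≡ i → r′ w ≡ i′) → (∀ {w} → w ≢ x → r′ w ≡ i′ → r w ≡ i) →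
                     othersLevel r i ≡ othersLevel r′ i′
  othersLevel-cong to from =
    filter-≐ _ _ ((λ (w≢x , e) → w≢x , to w≢x e) , (λ (w≢x , e) → w≢x , from w≢x e)) (allFin n)

  othersLevel-empty : {r : Rank n} {i : ℕ} → (∀ {w} → w ≢ x → r w ≢ i) → othersLevel r i ≡ []
  othersLevel-empty none = filter-none _ (All.universal (λ _ (w≢x , e) → none w≢x e) (allFin n))

  prefix : Rank n → ℕ → List (Fin n)
  prefix r c = concatMap (othersLevel r) (upTo c)

  prefix-suc : (r : Rank n) (c : ℕ) → prefix r (suc c) ≡ prefix r c ++ othersLevel r c
  prefix-suc r c = begin
    concatMap (othersLevel r) (upTo (suc c))      ≡⟨ cong (concatMap (othersLevel r)) (upTo-∷ʳ c) ⟨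
    concatMap (othersLevel r) (upTo c ++ [ c ])   ≡⟨ concatMap-++ (othersLevel r) (upTo c) [ c ] ⟩
    prefix r c ++ (othersLevel r c ++ [])         ≡⟨ cong (prefix r c ++_) (++-identityʳ (othersLevel r c)) ⟩
    prefix r c ++ othersLevel r c                 ∎

-- Moving a vertex away from the last rank

<ᵇ-true : {m k : ℕ} → m < k → (m <ᵇ k) ≡ true
<ᵇ-true {m} {k} m<k with m <ᵇ k | <ᵇ-reflects-< m k
... | true  | _       = refl
... | false | ofⁿ m≮k = ⊥-elim (m≮k m<k)

<ᵇ-false : {m k : ℕ} → k ≤ m → (m <ᵇ k) ≡ false
<ᵇ-false {m} {k} k≤m with m <ᵇ k | <ᵇ-reflects-< m k
... | false | _       = refl
... | true  | ofʸ m<k = ⊥-elim (≤⇒≯ k≤m m<k)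

rank-injective : (σ : Permutation′ n) {v w : Fin n} → rank σ v ≡ rank σ w → v ≡ w
rank-injective σ {v} {w} e = begin
  v                        ≡⟨ inverseˡ σ ⟨
  σ ⟨$⟩ˡ (σ ⟨$⟩ʳ v)        ≡⟨ cong (σ ⟨$⟩ˡ_) (toℕ-injective e) ⟩
  σ ⟨$⟩ˡ (σ ⟨$⟩ʳ w)        ≡⟨ inverseˡ σ ⟩
  w                        ∎

module _ (σ : Permutation′ n) (x j : Fin n) (x-last : suc (rank σ x) ≡ n)
         (τ : Rank n) (τ≗ : ∀ w → τ w ≡ reinsert σ x j w) where

  private
    r = rank σ
    J = toℕ j

  rank-below-last : {w : Fin n} → w ≢ x → r w < r x
  rank-below-last {w} w≢x =
    ≤∧≢⇒< (≤-pred (subst (r w <_) (sym x-last) (toℕ<n (σ ⟨$⟩ʳ w)))) (w≢x ∘ rank-injective σ)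

  reinsert-below : {w : Fin n} → w ≢ x → r w < J → τ w ≡ r w
  reinsert-below {w} w≢x w<J rewrite τ≗ w with w ≟ x
  ... | yes w≡x = ⊥-elim (w≢x w≡x)
  ... | no _ rewrite <ᵇ-true (rank-below-last w≢x) | <ᵇ-true w<J = refl

  reinsert-above : {w : Fin n} → w ≢ x → J ≤ r w → τ w ≡ suc (r w)
  reinsert-above {w} w≢x J≤w rewrite τ≗ w with w ≟ x
  ... | yes w≡x = ⊥-elim (w≢x w≡x)
  ... | no _ rewrite <ᵇ-true (rank-below-last w≢x) | <ᵇ-false J≤w = refl

  reinsert-cases : {w : Fin n} → w ≢ x → (r w < J × τ w ≡ r w) ⊎ (J ≤ r w × τ w ≡ suc (r w))
  reinsert-cases {w} w≢x with r w <? J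
  ... | yes w<J = inj₁ (w<J , reinsert-below w≢x w<J)
  ... | no  w≮J = inj₂ (≮⇒≥ w≮J , reinsert-above w≢x (≮⇒≥ w≮J))

  level-below : {i : ℕ} → i < J → othersLevel x τ i ≡ othersLevel x r i
  level-below {i} i<J = othersLevel-cong x to from
    where
    to : ∀ {w} → w ≢ x → τ w ≡ i → r w ≡ i
    to w≢x e with reinsert-cases w≢x
    ... | inj₁ (_ , τw) = trans (sym τw) e
    ... | inj₂ (J≤w , τw) = ⊥-elim (<⇒≱ i<J (≤-trans J≤w (subst (_ ≤_) (trans (sym τw) e) (n≤1+n _))))
    from : ∀ {w} → w ≢ x → r w ≡ i → τ w ≡ i
    from w≢x e = trans (reinsert-below w≢x (subst (_< J) (sym e) i<J)) e

  level-gap : othersLevel x τ J ≡ []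
  level-gap = othersLevel-empty x gap
    where
    gap : ∀ {w} → w ≢ x → τ w ≢ J
    gap w≢x e with reinsert-cases w≢x
    ... | inj₁ (w<J , τw) = <-irrefl (trans (sym τw) e) w<J
    ... | inj₂ (J≤w , τw) = <-irrefl (sym (trans (sym τw) e)) (s≤s J≤w)

  level-above : {i : ℕ} → J ≤ i → othersLevel x τ (suc i) ≡ othersLevel x r i
  level-above {i} J≤i = othersLevel-cong x to from
    where
    to : ∀ {w} → w ≢ x → τ w ≡ suc i → r w ≡ i
    to w≢x e with reinsert-cases w≢x
    ... | inj₁ (w<J , τw) = ⊥-elim (<⇒≱ w<J (≤-trans J≤i (subst (i ≤_) (sym (trans (sym τw) e)) (n≤1+n i))))
    ... | inj₂ (_ , τw)   = suc-injective (trans (sym τw) e)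
    from : ∀ {w} → w ≢ x → r w ≡ i → τ w ≡ suc i
    from w≢x e = trans (reinsert-above w≢x (subst (J ≤_) (sym e) J≤i)) (cong suc e)

  level-last : othersLevel x r (r x) ≡ []
  level-last = othersLevel-empty x (λ w≢x e → w≢x (rank-injective σ e))

  prefix-below : ∀ c → c ≤ J → prefix x τ c ≡ prefix x r c
  prefix-below zero    _     = refl
  prefix-below (suc c) c<J = begin
    prefix x τ (suc c)                  ≡⟨ prefix-suc x τ c ⟩
    prefix x τ c ++ othersLevel x τ c   ≡⟨ cong₂ _++_ (prefix-below c (<⇒≤ c<J)) (level-below c<J) ⟩
    prefix x r c ++ othersLevel x r c   ≡⟨ prefix-suc x r c ⟨
    prefix x r (suc c)                  ∎

  prefix-above : ∀ d → prefix x τ (suc (d + J)) ≡ prefix x r (d + J)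
  prefix-above zero = begin
    prefix x τ (suc J)                  ≡⟨ prefix-suc x τ J ⟩
    prefix x τ J ++ othersLevel x τ J   ≡⟨ cong₂ _++_ (prefix-below J ≤-refl) level-gap ⟩
    prefix x r J ++ []                  ≡⟨ ++-identityʳ (prefix x r J) ⟩
    prefix x r J                        ∎
  prefix-above (suc d) = begin
    prefix x τ (suc (suc d + J))                          ≡⟨ prefix-suc x τ (suc d + J) ⟩
    prefix x τ (suc (d + J)) ++ othersLevel x τ (suc (d + J))
      ≡⟨ cong₂ _++_ (prefix-above d) (level-above (m≤n+m J d)) ⟩
    prefix x r (d + J) ++ othersLevel x r (d + J)         ≡⟨ prefix-suc x r (d + J) ⟨
    prefix x r (suc d + J)                                ∎

  others-reinsert : others x (order τ) ≡ others x (order r)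
  others-reinsert = begin
    others x (order τ)                   ≡⟨ others-order x τ ⟩
    prefix x τ n                         ≡⟨ cong (prefix x τ) (trans (sym x-last) (cong suc (sym (m∸n+n≡m J≤x)))) ⟩
    prefix x τ (suc (r x ∸ J + J))       ≡⟨ prefix-above (r x ∸ J) ⟩
    prefix x r (r x ∸ J + J)             ≡⟨ cong (prefix x r) (m∸n+n≡m J≤x) ⟩
    prefix x r (r x)                     ≡⟨ ++-identityʳ (prefix x r (r x)) ⟨
    prefix x r (r x) ++ []               ≡⟨ cong (prefix x r (r x) ++_) level-last ⟨
    prefix x r (r x) ++ othersLevel x r (r x) ≡⟨ prefix-suc x r (r x) ⟨
    prefix x r (suc (r x))               ≡⟨ cong (prefix x r) x-last ⟩
    prefix x r n                         ≡⟨ others-order x r ⟨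
    others x (order r)                   ∎
    where
    J≤x : J ≤ r x
    J≤x = ≤-pred (subst (J <_) (sym x-last) (toℕ<n j))

order-cong : {r r′ : Rank n} → r ≗ r′ → order r ≡ order r′
order-cong {n} r≗r′ =
  concatMap-cong (λ i → filter-≐ _ _ ((λ e → trans (sym (r≗r′ _)) e) , (λ e → trans (r≗r′ _) e)) (allFin n))
                 (upTo n)

Mr-cong : (G : Graph n) {r r′ : Rank n} → r ≗ r′ → Mr G r ≡ Mr G r′
Mr-cong G r≗r′ = cong (λ o → foldl (probe G) (λ _ → nothing) (pairs o)) (order-cong r≗r′)

FreeIsolated : Graph n → Fin n → Rank n → FreeSet n
FreeIsolated G x r = run (isolate x (Graph.adj G)) (λ _ → true) (pairs (order r))

Free-nearlyAgree : (G : Graph n) (x : Fin n) (r : Rank n) → NearlyAgree x (Free G r) (FreeIsolated G x r)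
Free-nearlyAgree G x r = nearlyAgree-run (Graph.adj G) x (inj₁ (refl , λ _ _ _ → refl)) (pairs (order r))

FreeIsolated-reinsert : (G : Graph n) (σ : Permutation′ n) (x j : Fin n) → suc (rank σ x) ≡ n →
  (τ : Rank n) → (∀ w → τ w ≡ reinsert σ x j w) → FreeIsolated G x τ ≡ FreeIsolated G x (rank σ)
FreeIsolated-reinsert G σ x j x-last τ τ≗ = begin
  run A′ all (pairs (order τ))                ≡⟨ run-isolated-others (Graph.adj G) x all (order τ) ⟩
  run A′ all (pairs (others x (order τ)))     ≡⟨ cong (λ L → run A′ all (pairs L)) (others-reinsert σ x j x-last τ τ≗) ⟩
  run A′ all (pairs (others x (order (rank σ)))) ≡⟨ run-isolated-others (Graph.adj G) x all (order (rank σ)) ⟨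
  run A′ all (pairs (order (rank σ)))         ∎
  where
  A′  = isolate x (Graph.adj G)
  all = λ (_ : Fin _) → true

module _ (G : Graph n) (r : Rank n) {v : Fin n} where

  unmatched⇒free : UnmatchedR G r v → Free G r v ≡ true
  unmatched⇒free e = trans (sym (free-Mr G r v)) (cong is-nothing e)

  matched⇒taken : MatchedR G r v → Free G r v ≡ false
  matched⇒taken (_ , e) = trans (sym (free-Mr G r v)) (cong is-nothing e)

free-neighbour-unique : (G : Graph n) (σ : Permutation′ n) {x j : Fin n} →
  suc (rank σ x) ≡ n → Unmatched G σ x → (τ : Rank n) → (∀ w → τ w ≡ reinsert σ x j w) → MatchedR G τ x →
  {y z : Fin n} → Graph.adj G x y ≡ true → Graph.adj G x z ≡ true →
  UnmatchedR G τ y → UnmatchedR G τ z → y ≡ z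
free-neighbour-unique G σ {x} {j} x-last x-free τ τ≗ x-matched {y} {z} xy xz y-free z-free =
  decidable-stable (y ≟ z) y≢z-absurd
  where
  σx-free : Free G (rank σ) x ≡ true
  σx-free = unmatched⇒free G (rank σ) x-free

  τx-taken : Free G τ x ≡ false
  τx-taken = matched⇒taken G τ x-matched

  τ-close : ∃[ d ] AgreeOff x d (Free G τ) (FreeIsolated G x τ)
  τ-close with Free-nearlyAgree G x τ
  ... | inj₁ (τx , _)    with () ← trans (sym τx) τx-taken
  ... | inj₂ (_ , close) = close

  σ-agree : AgreeOff x x (Free G (rank σ)) (FreeIsolated G x (rank σ))
  σ-agree with Free-nearlyAgree G x (rank σ)
  ... | inj₁ (_ , agree) = agree
  ... | inj₂ (σx , _)    with () ← trans (sym σx-free) σx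

  d = proj₁ τ-close

  x≢free : ∀ {w} → UnmatchedR G τ w → x ≢ w
  x≢free w-free refl with () ← trans (sym (unmatched⇒free G τ w-free)) τx-taken

  free-in-σ : ∀ {w} → UnmatchedR G τ w → w ≢ d → Free G (rank σ) w ≡ true
  free-in-σ {w} w-free w≢d = begin
    Free G (rank σ) w           ≡⟨ σ-agree w w≢x w≢x ⟩
    FreeIsolated G x (rank σ) w ≡⟨ cong-app (FreeIsolated-reinsert G σ x j x-last τ τ≗) w ⟨
    FreeIsolated G x τ w        ≡⟨ proj₂ τ-close w w≢x w≢d ⟨
    Free G τ w                  ≡⟨ unmatched⇒free G τ w-free ⟩
    true                        ∎
    where
    w≢x : w ≢ x
    w≢x = x≢free w-free ∘ sym

  not-free-in-σ : ∀ {w} → Graph.adj G x w ≡ true → UnmatchedR G τ w → w ≢ d → ⊥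
  not-free-in-σ xw w-free w≢d with Free-maximal G σ (x≢free w-free) xw
  ... | inj₁ σx-taken with () ← trans (sym σx-free) σx-taken
  ... | inj₂ σw-taken with () ← trans (sym (free-in-σ w-free w≢d)) σw-taken

  y≢z-absurd : ¬ y ≢ z
  y≢z-absurd y≢z with y ≟ d
  ... | yes y≡d = not-free-in-σ xz z-free (λ z≡d → y≢z (trans y≡d (sym z≡d)))
  ... | no  y≢d = not-free-in-σ xy y-free y≢d

lemma7 : ∀ {n} (G : Graph n) (P : PerfectMatching G) (ρ : Permutation′ n) (x : Fin n) →
    InQ G ρ x →
    ¬ (ProducedFromRn G P 1 ρ x × ProducedFromRn G P 3 ρ x × ProducedFromRn G P 6 ρ x)
lemma7 G P ρ x x-matched
  ( (σ₁ , u₁ , _ , j₁ , ρ≗₁ , r1 u₁-free)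
  , (σ₃ , _ , (x-last , x-free) , j₃ , ρ≗₃ , r3 _)
  , (σ₆ , u₆ , (_ , u₆-free) , j₆ , ρ≗₆ , r6 _ u₆*-free u₆*↦x) )
  = case trans (sym u₆-free) u₆-matched of λ ()
  where
  open PerfectMatching P

  in-ρ : ∀ {σ u j v} → (∀ w → rank ρ w ≡ reinsert σ u j w) →
         UnmatchedR G (reinsert σ u j) v → UnmatchedR G (rank ρ) v
  in-ρ {v = v} ρ≗ v-free = trans (cong-app (Mr-cong G ρ≗) v) v-free

  u₁≡u₆* : u₁ ≡ mate u₆
  u₁≡u₆* = free-neighbour-unique G σ₃ x-last x-free (rank ρ) ρ≗₃ x-matched
             (trans (Graph.sym G (mate u₁) u₁) (mate-edge u₁))
             (trans (Graph.sym G (mate u₁) (mate u₆)) (proj₁ (Mr-partners G (rank σ₆) u₆*↦x)))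
             (in-ρ {σ₁} {u₁} {j₁} ρ≗₁ u₁-free) (in-ρ {σ₆} {u₆} {j₆} ρ≗₆ u₆*-free)

  u₆-matched : M G σ₆ u₆ ≡ just (mate u₆)
  u₆-matched = subst (λ v → M G σ₆ v ≡ just (mate u₆)) (trans (cong mate u₁≡u₆*) (mate-inv u₆))
                     (proj₂ (Mr-partners G (rank σ₆) u₆*↦x))
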